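{- Let $a_1,a_2$ be relatively prime odd integers. Then for every integer $m$ there exist $c,d,u,v\in\mathbb{Z}$ such that $\gcd\big(a_1(u-c),\,a_2(v-d)\big)=1$ and $a_1(c^2+2u)+a_2(d^2+2v)=m$. -}

module Defs where

open import Data.Integer.Base using (ℤ; +_)
open import Data.Integer.Divisibility using (_∣_)
open import Relation.Nullary using (¬_)

Odd : ℤ → Set
Odd a = ¬ (+ 2 ∣ a)

module Submission where

-- Write Q(x) = x² + 2x = (x + 1)² − 1.  Coprimality is handled constructively
-- through Bézout identities ('Bezout a b': s·a + t·b = 1); the file first develops
-- this relation and its links to 'Coprime' and 'gcd', then argues in three steps.
-- 1. If a ≠ 0 is coprime to p, then for every K some p·e² − K is coprime to a:
--    take for e the part of |a| coprime to K ('coprimePart').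
-- 2. Applying 1 to (a₁, a₂, m + a₂) and (a₂, a₁, m + a₁) gives e₁, e₂; with
--    d = e₁ − 1 and c = e₂ − 1 + a₂·w (w fixing the parity of c + d), the defect
--    M = m − a₁Q(c) − a₂Q(d) is even, M = 2N, and N is coprime to a₁ and a₂
--    because M ≡ −(a₂e₁² − m − a₂) mod a₁ and M ≡ −(a₁e₂² − m − a₁) mod a₂.
-- 3. From s·a₁ + t·a₂ = 1, x = N·s + a₂ and y = N·t − a₁ satisfy a₁x + a₂y = N
--    and a₁x ⊥ a₂y.
-- Then u = c + x, v = d + y work: a₁(c² + 2u) + a₂(d² + 2v) = m − M + 2N = m.

open import Defs
open import Data.Integer.Base using (ℤ; +_; _+_; _-_; _*_; -_; ∣_∣)
open import Data.Integer.GCD using (gcd; gcd[i,j]∣i; gcd[i,j]∣j)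
open import Data.Integer.Coprimality using (Coprime)
open import Data.Integer.Divisibility.Signed
  using (_∣_; divides; ∣ᵤ⇒∣; ∣⇒∣ᵤ; m∣∣m∣; ∣m∣n⇒∣m+n; ∣m∣n⇒∣m-n; ∣m⇒∣-m; ∣n⇒∣m*n; ∣m⇒∣m*n)
open import Data.Integer.Properties using (pos-+; pos-*; +-comm; *-comm; neg-distribˡ-*; ∣i∣≡0⇒i≡0; +-identityˡ; *-identityʳ)
open import Data.Integer.Tactic.RingSolver using (solve-∀)
open import Data.Integer.DivMod using (_/ℕ_; _%ℕ_; a≡a%ℕn+[a/ℕn]*n; n%ℕd<d)
open import Data.Nat.Base as ℕ using (ℕ; suc; _<_; s≤s)
import Data.Nat.Properties as ℕ
import Data.Nat.Divisibility as ℕ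
import Data.Nat.GCD as ℕ
import Data.Nat.Coprimality as ℕ
open import Data.Nat.Induction using (<-rec)
open import Function.Base using (_∘_)
open import Data.Product using (∃-syntax; _×_; _,_)
open import Data.Sum using (_⊎_; inj₁; inj₂)
open import Data.Empty using (⊥-elim)
open import Relation.Nullary using (yes; no)
open import Relation.Binary.PropositionalEquality
  using (_≡_; _≢_; refl; sym; trans; cong; cong₂; subst; subst₂; module ≡-Reasoning)

-- a and b satisfy a Bézout identity; over ℤ this is coprimality.  A record
-- (rather than a Σ-type) so that a and b can be inferred from a proof.
record Bezout (a b : ℤ) : Set where
  constructor bezout
  field
    s t      : ℤ
    identity : s * a + t * b ≡ + 1

Bezout-sym : ∀ {a b} → Bezout a b → Bezout b a
Bezout-sym {a} {b} (bezout s t eq) = bezout t s (trans (+-comm (t * b) (s * a)) eq)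

Bezout-*ʳ : ∀ {a b c} → Bezout a b → Bezout a c → Bezout a (b * c)
Bezout-*ʳ {a} {b} {c} (bezout s t eq) (bezout s′ t′ eq′) =
  bezout (s * s′ * a + s * t′ * c + t * b * s′) (t * t′)
    (trans (expand a b c s t s′ t′) (cong₂ _*_ eq eq′))
  where
  expand : ∀ a b c s t s′ t′ →
    (s * s′ * a + s * t′ * c + t * b * s′) * a + t * t′ * (b * c)
      ≡ (s * a + t * b) * (s′ * a + t′ * c)
  expand = solve-∀

Bezout-∣ʳ : ∀ {a b d} → d ∣ b → Bezout a b → Bezout a d
Bezout-∣ʳ {a} {b} {d} (divides q refl) (bezout s t eq) = bezout s (t * q) (trans (reassoc s a t q d) eq)
  where
  reassoc : ∀ s a t q d → s * a + t * q * d ≡ s * a + t * (q * d)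
  reassoc = solve-∀

Bezout-∣ˡ : ∀ {a b d} → d ∣ a → Bezout a b → Bezout d b
Bezout-∣ˡ d∣a = Bezout-sym ∘ Bezout-∣ʳ d∣a ∘ Bezout-sym

Bezout-negʳ : ∀ {a b} → Bezout a b → Bezout a (- b)
Bezout-negʳ {a} {b} (bezout s t eq) = bezout s (- t) (trans (negate s a t b) eq)
  where
  negate : ∀ s a t b → s * a + (- t) * (- b) ≡ s * a + t * b
  negate = solve-∀

Bezout-+ʳ : ∀ {a b} k → Bezout a b → Bezout a (b + k * a)
Bezout-+ʳ {a} {b} k (bezout s t eq) = bezout (s - t * k) t (trans (shift s t k a b) eq)
  where
  shift : ∀ s t k a b → (s - t * k) * a + t * (b + k * a) ≡ s * a + t * b
  shift = solve-∀

-- A Bézout identity between naturals, in the form produced by the extended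
-- Euclidean algorithm, becomes one over ℤ.
ℕ-identity⇒Bezout : ∀ {m n} x y → 1 ℕ.+ y ℕ.* n ≡ x ℕ.* m → Bezout (+ m) (+ n)
ℕ-identity⇒Bezout {m} {n} x y eq = bezout (+ x) (- + y) (begin
  + x * + m + - + y * + n             ≡⟨ cong (λ z → z + - + y * + n) (sym eqℤ) ⟩
  + 1 + + y * + n + - + y * + n       ≡⟨ cancel (+ y) (+ n) ⟩
  + 1                                 ∎)
  where
  open ≡-Reasoning
  eqℤ : + 1 + + y * + n ≡ + x * + m
  eqℤ = begin
    + 1 + + y * + n      ≡⟨ cong (_+_ (+ 1)) (pos-* y n) ⟨
    + 1 + + (y ℕ.* n)    ≡⟨ pos-+ 1 (y ℕ.* n) ⟨
    + (1 ℕ.+ y ℕ.* n)    ≡⟨ cong +_ eq ⟩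
    + (x ℕ.* m)          ≡⟨ pos-* x m ⟩
    + x * + m            ∎
  cancel : ∀ y n → + 1 + y * n + - y * n ≡ + 1
  cancel = solve-∀

coprime⇒Bezout : ∀ {a b} → Coprime a b → Bezout a b
coprime⇒Bezout {a} {b} cop = Bezout-∣ˡ m∣∣m∣ (Bezout-sym (Bezout-∣ˡ m∣∣m∣ (Bezout-sym onAbs)))
  where
  onAbs : Bezout (+ ∣ a ∣) (+ ∣ b ∣)
  onAbs with ℕ.coprime-Bézout cop
  ... | ℕ.Bézout.+- x y eq = ℕ-identity⇒Bezout x y eq
  ... | ℕ.Bézout.-+ x y eq = Bezout-sym (ℕ-identity⇒Bezout y x eq)

-- A Bézout identity forces the gcd to be 1: the gcd divides s·a + t·b = 1.
Bezout⇒gcd≡1 : ∀ {a b} → Bezout a b → gcd a b ≡ + 1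
Bezout⇒gcd≡1 {a} {b} (bezout s t eq) = cong +_ (ℕ.∣1⇒≡1 (∣⇒∣ᵤ gcd∣1))
  where
  gcd∣1 : gcd a b ∣ + 1
  gcd∣1 = subst (gcd a b ∣_) eq
    (∣m∣n⇒∣m+n (∣n⇒∣m*n s (∣ᵤ⇒∣ (gcd[i,j]∣i a b))) (∣n⇒∣m*n t (∣ᵤ⇒∣ (gcd[i,j]∣j a b))))

-- Stripping from a nonzero A every factor it shares with K leaves a part e
-- coprime to K, and anything coprime to e and to gcd(A, K) is coprime to A.
-- Induction on A: if g = gcd(A, K) ≠ 1, write A = q·g with q < A and note
-- that gcd(q, K) divides g.
coprimePart : ∀ (K : ℤ) (A : ℕ) → A ≢ 0 →
  ∃[ e ] Bezout e K × (∀ f → Bezout f e → Bezout f (gcd (+ A) K) → Bezout f (+ A))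
coprimePart K = <-rec Goal step
  where
  Goal : ℕ → Set
  Goal A = A ≢ 0 →
    ∃[ e ] Bezout e K × (∀ f → Bezout f e → Bezout f (gcd (+ A) K) → Bezout f (+ A))

  step : ∀ A → (∀ {q} → q < A → Goal q) → Goal A
  step A rec A≢0 with ℕ.gcd A ∣ K ∣ ℕ.≟ 1
  ... | yes g≡1 = + A , coprime⇒Bezout (ℕ.gcd≡1⇒coprime g≡1) , λ _ f⊥A _ → f⊥A
  ... | no g≢1 = peel (ℕ.gcd[m,n]∣m A ∣ K ∣)
    where
    g : ℕ
    g = ℕ.gcd A ∣ K ∣

    1<g : 1 < g
    1<g = ℕ.≤∧≢⇒< (ℕ.n≢0⇒n>0 (A≢0 ∘ ℕ.gcd[m,n]≡0⇒m≡0)) (g≢1 ∘ sym)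

    peel : g ℕ.∣ A → ∃[ e ] Bezout e K × (∀ f → Bezout f e → Bezout f (+ g) → Bezout f (+ A))
    peel (ℕ.divides q A≡q*g) with rec q<A q≢0
      where
      q≢0 : q ≢ 0
      q≢0 q≡0 = A≢0 (trans A≡q*g (cong (ℕ._* g) q≡0))
      q<A : q < A
      q<A = subst (q <_) (sym A≡q*g) (ℕ.m<m*n q g {{ℕ.≢-nonZero q≢0}} 1<g)
    ... | e , e⊥K , reduce = e , e⊥K , λ f f⊥e f⊥g →
      subst (Bezout f) (sym A≡q*gℤ) (Bezout-*ʳ (reduce f f⊥e (Bezout-∣ʳ gcd[q,K]∣g f⊥g)) f⊥g)
      where
      A≡q*gℤ : + A ≡ + q * + g
      A≡q*gℤ = trans (cong +_ A≡q*g) (pos-* q g)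
      gcd[q,K]∣g : gcd (+ q) K ∣ + g
      gcd[q,K]∣g = ∣ᵤ⇒∣ (ℕ.gcd-greatest
        (ℕ.∣-trans (ℕ.gcd[m,n]∣m q ∣ K ∣) (subst (q ℕ.∣_) (sym A≡q*g) (ℕ.m∣m*n g)))
        (ℕ.gcd[m,n]∣n q ∣ K ∣))

-- With e from 'coprimePart' applied to |a|:
-- e ⊥ p·e² − K because e ⊥ K, and gcd(a, K) ⊥ p·e² − K because gcd(a, K)
-- divides K and is coprime to p (it divides a) and to e (it divides K).
quadraticCoprimeValue : ∀ {a p} → a ≢ + 0 → Bezout a p → ∀ K → ∃[ e ] Bezout a (p * e * e - K)
quadraticCoprimeValue {a} {p} a≢0 a⊥p K with coprimePart K ∣ a ∣ (a≢0 ∘ ∣i∣≡0⇒i≡0)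
... | e , e⊥K , reduce =
  e , Bezout-∣ˡ m∣∣m∣ (Bezout-sym (reduce f (Bezout-sym e⊥f) (Bezout-sym g⊥f)))
  where
  f : ℤ
  f = p * e * e - K
  g : ℤ
  g = gcd a K
  e⊥f : Bezout e f
  e⊥f = subst (Bezout e) (+-comm (- K) (p * e * e)) (Bezout-+ʳ (p * e) (Bezout-negʳ e⊥K))
  g⊥p : Bezout g p
  g⊥p = Bezout-∣ˡ (∣ᵤ⇒∣ (gcd[i,j]∣i a K)) a⊥p
  g⊥f : Bezout g f
  g⊥f with ∣ᵤ⇒∣ (gcd[i,j]∣j a K)
  ... | divides k K≡k*g = subst (Bezout g) (cong (_+_ (p * e * e)) -k*g≡-K)
        (Bezout-+ʳ (- k) (Bezout-*ʳ (Bezout-*ʳ g⊥p g⊥e) g⊥e))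
    where
    g⊥e : Bezout g e
    g⊥e = Bezout-sym (Bezout-∣ʳ (divides k K≡k*g) e⊥K)
    -k*g≡-K : - k * g ≡ - K
    -k*g≡-K = trans (sym (neg-distribˡ-* k g)) (cong -_ (sym K≡k*g))

parity : ∀ x → ∃[ q ] (x ≡ q * + 2 ⊎ x ≡ q * + 2 + + 1)
parity x = byRemainder (x %ℕ 2) (n%ℕd<d x 2) (a≡a%ℕn+[a/ℕn]*n x 2)
  where
  byRemainder : ∀ r → r < 2 → x ≡ + r + (x /ℕ 2) * + 2 → ∃[ q ] (x ≡ q * + 2 ⊎ x ≡ q * + 2 + + 1)
  byRemainder 0 _ eq = x /ℕ 2 , inj₁ (trans eq (+-identityˡ ((x /ℕ 2) * + 2)))
  byRemainder 1 _ eq = x /ℕ 2 , inj₂ (trans eq (+-comm (+ 1) ((x /ℕ 2) * + 2)))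
  byRemainder (suc (suc _)) (s≤s (s≤s ()))

odd⇒2∣a-1 : ∀ a → Odd a → + 2 ∣ a - + 1
odd⇒2∣a-1 a odd with parity a
... | q , inj₁ refl = ⊥-elim (odd (∣⇒∣ᵤ (divides q refl)))
... | q , inj₂ refl = divides q (lower q)
  where
  lower : ∀ q → q * + 2 + + 1 - + 1 ≡ q * + 2
  lower = solve-∀

odd⇒≢0 : ∀ a → Odd a → a ≢ + 0
odd⇒≢0 _ odd refl = odd (∣⇒∣ᵤ {+ 2} (divides (+ 0) refl))

2∣x²+x : ∀ x → + 2 ∣ x * x + x
2∣x²+x x with parity x
... | q , inj₁ refl = divides (q * q * + 2 + q) (evenCase q)
  where
  evenCase : ∀ q → q * + 2 * (q * + 2) + q * + 2 ≡ (q * q * + 2 + q) * + 2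
  evenCase = solve-∀
... | q , inj₂ refl = divides (q * q * + 2 + q * + 3 + + 1) (oddCase q)
  where
  oddCase : ∀ q → (q * + 2 + + 1) * (q * + 2 + + 1) + (q * + 2 + + 1) ≡ (q * q * + 2 + q * + 3 + + 1) * + 2
  oddCase = solve-∀

-- Parity of the defect: if a₁, a₂ are odd and c + d ≡ m (mod 2), then
-- m − a₁(c² + 2c) − a₂(d² + 2d) is even, being a sum of multiples of
-- c + d − m, c² + c, d² + d, a₁ − 1 and a₂ − 1.
evenDefect : ∀ a₁ a₂ → Odd a₁ → Odd a₂ → ∀ m c d → + 2 ∣ c + d - m →
  + 2 ∣ m - a₁ * (c * c + + 2 * c) - a₂ * (d * d + + 2 * d)
evenDefect a₁ a₂ odd₁ odd₂ m c d 2∣c+d-m = subst (+ 2 ∣_) (sym (regroup a₁ a₂ m c d))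
  (∣m∣n⇒∣m-n (∣m∣n⇒∣m-n (∣m∣n⇒∣m-n (∣m∣n⇒∣m-n (∣m⇒∣-m 2∣c+d-m) (2∣x²+x c)) (2∣x²+x d))
    (∣m⇒∣m*n (c * c + + 2 * c) (odd⇒2∣a-1 a₁ odd₁)))
    (∣m⇒∣m*n (d * d + + 2 * d) (odd⇒2∣a-1 a₂ odd₂)))
  where
  regroup : ∀ a₁ a₂ m c d →
    m - a₁ * (c * c + + 2 * c) - a₂ * (d * d + + 2 * d)
      ≡ - (c + d - m) - (c * c + c) - (d * d + d)
        - (a₁ - + 1) * (c * c + + 2 * c) - (a₂ - + 1) * (d * d + + 2 * d)
  regroup = solve-∀

-- Splitting N: if a₁ ⊥ a₂ via s·a₁ + t·a₂ = 1 and N is coprime to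
-- both, then x = N·s + a₂ and y = N·t − a₁ give N = a₁x + a₂y with a₁x ⊥ a₂y.
-- Indeed a₁ ⊥ y (y ≡ N·t mod a₁), a₂ ⊥ x (x ≡ N·s mod a₂), and t·x − s·y = 1.
splitCoprime : ∀ {a₁ a₂ N} → Bezout a₁ a₂ → Bezout a₁ N → Bezout a₂ N →
  ∃[ x ] ∃[ y ] a₁ * x + a₂ * y ≡ N × Bezout (a₁ * x) (a₂ * y)
splitCoprime {a₁} {a₂} {N} a₁⊥a₂@(bezout s t st) a₁⊥N a₂⊥N =
  x , y , a₁x+a₂y≡N , Bezout-sym (Bezout-*ʳ (Bezout-sym a₁⊥a₂y) (Bezout-sym x⊥a₂y))
  where
  x y : ℤ
  x = N * s + a₂
  y = N * t - a₁
  a₁⊥t : Bezout a₁ t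
  a₁⊥t = bezout s a₂ (trans (cong (_+_ (s * a₁)) (*-comm a₂ t)) st)
  a₂⊥s : Bezout a₂ s
  a₂⊥s = bezout t a₁ (trans (+-comm (t * a₂) (a₁ * s)) (trans (cong (_+ t * a₂) (*-comm a₁ s)) st))
  a₁⊥y : Bezout a₁ y
  a₁⊥y = subst (Bezout a₁) (minusOne (N * t) a₁) (Bezout-+ʳ (- + 1) (Bezout-*ʳ a₁⊥N a₁⊥t))
    where
    minusOne : ∀ b a → b + - + 1 * a ≡ b - a
    minusOne = solve-∀
  a₂⊥x : Bezout a₂ x
  a₂⊥x = subst (Bezout a₂) (plusOne (N * s) a₂) (Bezout-+ʳ (+ 1) (Bezout-*ʳ a₂⊥N a₂⊥s))
    where
    plusOne : ∀ b a → b + + 1 * a ≡ b + a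
    plusOne = solve-∀
  x⊥y : Bezout x y
  x⊥y = bezout t (- s) (trans (cross t s N a₁ a₂) st)
    where
    cross : ∀ t s N a₁ a₂ → t * (N * s + a₂) + - s * (N * t - a₁) ≡ s * a₁ + t * a₂
    cross = solve-∀
  a₁⊥a₂y : Bezout a₁ (a₂ * y)
  a₁⊥a₂y = Bezout-*ʳ a₁⊥a₂ a₁⊥y
  x⊥a₂y : Bezout x (a₂ * y)
  x⊥a₂y = Bezout-*ʳ (Bezout-sym a₂⊥x) x⊥y
  a₁x+a₂y≡N : a₁ * x + a₂ * y ≡ N
  a₁x+a₂y≡N = begin
    a₁ * (N * s + a₂) + a₂ * (N * t - a₁) ≡⟨ expand a₁ a₂ N s t ⟩
    N * (s * a₁ + t * a₂)                 ≡⟨ cong (N *_) st ⟩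
    N * + 1                               ≡⟨ *-identityʳ N ⟩
    N                                     ∎
    where
    open ≡-Reasoning
    expand : ∀ a₁ a₂ N s t → a₁ * (N * s + a₂) + a₂ * (N * t - a₁) ≡ N * (s * a₁ + t * a₂)
    expand = solve-∀

-- Choice of c and d from residues e₁, e₂ of the quadratics a₂e² − m − a₂ and
-- a₁e² − m − a₁ coprime to a₁ resp. a₂: d = e₁ − 1 gives d² + 2d = e₁² − 1, so the
-- defect M = m − a₁(c² + 2c) − a₂(d² + 2d) is ≡ −(a₂e₁² − m − a₂) mod a₁; likewise
-- c = e₂ − 1 + a₂w gives M ≡ −(a₁e₂² − m − a₁) mod a₂, and w = m − (e₂ − 1) − d
-- makes c + d − m = (a₂ − 1)w even, so M = 2N with N coprime to a₁ and a₂.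
defectFromResidues : ∀ {a₁ a₂} → Odd a₁ → Odd a₂ → ∀ m e₁ e₂ →
  Bezout a₁ (a₂ * e₁ * e₁ - (m + a₂)) → Bezout a₂ (a₁ * e₂ * e₂ - (m + a₁)) →
  ∃[ c ] ∃[ d ] ∃[ N ] a₁ * (c * c + + 2 * c) + a₂ * (d * d + + 2 * d) + N * + 2 ≡ m
    × Bezout a₁ N × Bezout a₂ N
defectFromResidues {a₁} {a₂} odd₁ odd₂ m e₁ e₂ a₁⊥value a₂⊥value =
  c , d , halve (evenDefect a₁ a₂ odd₁ odd₂ m c d 2∣c+d-m)
  where
  d w c M : ℤ
  d = e₁ - + 1
  w = m - (e₂ - + 1) - d
  c = e₂ - + 1 + a₂ * w
  M = m - a₁ * (c * c + + 2 * c) - a₂ * (d * d + + 2 * d)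

  2∣c+d-m : + 2 ∣ c + d - m
  2∣c+d-m = subst (+ 2 ∣_) (sym (parityShift a₂ e₂ d m)) (∣m⇒∣m*n w (odd⇒2∣a-1 a₂ odd₂))
    where
    parityShift : ∀ a₂ e₂ d m → e₂ - + 1 + a₂ * (m - (e₂ - + 1) - d) + d - m
                                  ≡ (a₂ - + 1) * (m - (e₂ - + 1) - d)
    parityShift = solve-∀

  a₁⊥M : Bezout a₁ M
  a₁⊥M = subst (Bezout a₁) (sym (modA₁ a₁ a₂ e₁ m c))
    (Bezout-+ʳ (- (c * c + + 2 * c)) (Bezout-negʳ a₁⊥value))
    where
    modA₁ : ∀ a₁ a₂ e₁ m c →
      m - a₁ * (c * c + + 2 * c) - a₂ * ((e₁ - + 1) * (e₁ - + 1) + + 2 * (e₁ - + 1))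
        ≡ - (a₂ * e₁ * e₁ - (m + a₂)) + - (c * c + + 2 * c) * a₁
    modA₁ = solve-∀

  a₂⊥M : Bezout a₂ M
  a₂⊥M = subst (Bezout a₂) (sym (modA₂ a₁ a₂ e₂ m w d))
    (Bezout-+ʳ (- (a₁ * (+ 2 * e₂ * w + a₂ * w * w) + d * d + + 2 * d)) (Bezout-negʳ a₂⊥value))
    where
    modA₂ : ∀ a₁ a₂ e₂ m w d →
      m - a₁ * ((e₂ - + 1 + a₂ * w) * (e₂ - + 1 + a₂ * w) + + 2 * (e₂ - + 1 + a₂ * w))
        - a₂ * (d * d + + 2 * d)
        ≡ - (a₁ * e₂ * e₂ - (m + a₁)) + - (a₁ * (+ 2 * e₂ * w + a₂ * w * w) + d * d + + 2 * d) * a₂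
    modA₂ = solve-∀

  halve : + 2 ∣ M → ∃[ N ] a₁ * (c * c + + 2 * c) + a₂ * (d * d + + 2 * d) + N * + 2 ≡ m
                             × Bezout a₁ N × Bezout a₂ N
  halve (divides N M≡N*2) = N , total , Bezout-∣ʳ N∣M a₁⊥M , Bezout-∣ʳ N∣M a₂⊥M
    where
    N∣M : N ∣ M
    N∣M = divides (+ 2) (trans M≡N*2 (*-comm N (+ 2)))
    addBack : ∀ p q m → p + q + (m - p - q) ≡ m
    addBack = solve-∀
    total : a₁ * (c * c + + 2 * c) + a₂ * (d * d + + 2 * d) + N * + 2 ≡ m
    total = trans (cong (_+_ (a₁ * (c * c + + 2 * c) + a₂ * (d * d + + 2 * d))) (sym M≡N*2))
                  (addBack (a₁ * (c * c + + 2 * c)) (a₂ * (d * d + + 2 * d)) m)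

assemble : ∀ a₁ a₂ m c d N x y →
  a₁ * (c * c + + 2 * c) + a₂ * (d * d + + 2 * d) + N * + 2 ≡ m →
  a₁ * x + a₂ * y ≡ N → Bezout (a₁ * x) (a₂ * y) →
  gcd (a₁ * (c + x - c)) (a₂ * (d + y - d)) ≡ + 1
    × a₁ * (c * c + + 2 * (c + x)) + a₂ * (d * d + + 2 * (d + y)) ≡ m
assemble a₁ a₂ m c d N x y total a₁x+a₂y≡N a₁x⊥a₂y = gcd≡1 , equation
  where
  open ≡-Reasoning
  cancel : ∀ c x → c + x - c ≡ x
  cancel = solve-∀
  gcd≡1 : gcd (a₁ * (c + x - c)) (a₂ * (d + y - d)) ≡ + 1
  gcd≡1 = subst₂ (λ x′ y′ → gcd (a₁ * x′) (a₂ * y′) ≡ + 1) (sym (cancel c x)) (sym (cancel d y))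
            (Bezout⇒gcd≡1 a₁x⊥a₂y)
  regroup : ∀ a₁ a₂ c d x y →
    a₁ * (c * c + + 2 * (c + x)) + a₂ * (d * d + + 2 * (d + y))
      ≡ a₁ * (c * c + + 2 * c) + a₂ * (d * d + + 2 * d) + (a₁ * x + a₂ * y) * + 2
  regroup = solve-∀
  equation : a₁ * (c * c + + 2 * (c + x)) + a₂ * (d * d + + 2 * (d + y)) ≡ m
  equation = begin
    a₁ * (c * c + + 2 * (c + x)) + a₂ * (d * d + + 2 * (d + y))
      ≡⟨ regroup a₁ a₂ c d x y ⟩
    a₁ * (c * c + + 2 * c) + a₂ * (d * d + + 2 * d) + (a₁ * x + a₂ * y) * + 2
      ≡⟨ cong (λ n → a₁ * (c * c + + 2 * c) + a₂ * (d * d + + 2 * d) + n * + 2) a₁x+a₂y≡N ⟩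
    a₁ * (c * c + + 2 * c) + a₂ * (d * d + + 2 * d) + N * + 2
      ≡⟨ total ⟩
    m ∎

lemma3p3 : (a₁ a₂ : ℤ) → Coprime a₁ a₂ → Odd a₁ → Odd a₂ → (m : ℤ) →
    ∃[ c ] ∃[ d ] ∃[ u ] ∃[ v ]
    (gcd (a₁ * (u - c)) (a₂ * (v - d)) ≡ + 1
    × a₁ * (c * c + + 2 * u) + a₂ * (d * d + + 2 * v) ≡ m)
lemma3p3 a₁ a₂ cop odd₁ odd₂ m =
  let a₁⊥a₂ = coprime⇒Bezout cop
      (e₁ , residue₁) = quadraticCoprimeValue (odd⇒≢0 a₁ odd₁) a₁⊥a₂ (m + a₂)
      (e₂ , residue₂) = quadraticCoprimeValue (odd⇒≢0 a₂ odd₂) (Bezout-sym a₁⊥a₂) (m + a₁)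
      (c , d , N , total , a₁⊥N , a₂⊥N) = defectFromResidues odd₁ odd₂ m e₁ e₂ residue₁ residue₂
      (x , y , a₁x+a₂y≡N , a₁x⊥a₂y) = splitCoprime a₁⊥a₂ a₁⊥N a₂⊥N
  in c , d , c + x , d + y , assemble a₁ a₂ m c d N x y total a₁x+a₂y≡N a₁x⊥a₂y
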